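{- Let $r,t$ be integers with $t\geq 1$ and $t+1\le r\le 4t-2$. Let $G$ be a multi $r$-edge-colored complete graph in which every edge has exactly $t$ different colors. Then $V(G)$ can be covered by at most $r-t$ monochromatic components.
   Context: A complete graph $G$ is multi $r$-edge-colored if to each pair of distinct vertices $u,v$ a set $\emptyset\neq \mathrm{col}(uv)\subseteq [r]=\{1,\dots,r\}$ of colors is assigned, and the coloring is transitive: if $i\in \mathrm{col}(uv)\cap\mathrm{col}(vw)$ for distinct $u,v,w$, then $i\in\mathrm{col}(uw)$. The edge $uv$ has color $i$ if $i\in\mathrm{col}(uv)$. A monochromatic component of color $i$ is (the vertex set of) a connected component of the spanning subgraph of $G$ formed by the edges having color $i$. -}

module Defs where

open import Data.Nat using (ℕ)
open import Data.Fin using (Fin)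
open import Data.Fin.Subset using (Subset; _∈_; ∣_∣)
open import Data.Product using (_×_)
open import Relation.Binary.PropositionalEquality using (_≡_; _≢_)

-- A multi r-edge-colouring of the complete graph on vertex set Fin n:
-- col u v is the set of colours of the edge uv (only meaningful for u ≢ v).
Colouring : ℕ → ℕ → Set
Colouring n r = Fin n → Fin n → Subset r

Symmetric : ∀ {n r} → Colouring n r → Set
Symmetric {n} col = (u v : Fin n) → u ≢ v → col u v ≡ col v u

Transitive : ∀ {n r} → Colouring n r → Set
Transitive {n} {r} col = (u v w : Fin n) (i : Fin r) →
  u ≢ v → v ≢ w → u ≢ w → i ∈ col u v → i ∈ col v w → i ∈ col u w

ExactlyColours : ∀ {n r} → ℕ → Colouring n r → Set
ExactlyColours {n} t col = (u v : Fin n) → u ≢ v → ∣ col u v ∣ ≡ t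

-- Reach col i u w : w lies in the monochromatic component of colour i
-- containing u (a walk from u to w along edges having colour i).
data Reach {n r : ℕ} (col : Colouring n r) (i : Fin r) : Fin n → Fin n → Set where
  here : ∀ {u} → Reach col i u u
  step : ∀ {u v w} → u ≢ v → i ∈ col u v → Reach col i v w → Reach col i u w

-- Fix a vertex v. If some t-set T of colours is the colour set of no edge at v, then every other
-- vertex is joined to v by an edge with a colour outside T, so the r − t components of v in the
-- colours outside T cover everything. Otherwise every t-set T is realised by an edge v w_T, and
-- transitivity through v gives col(w_T w_U) ∩ (T ∪ U) = T ∩ U. If r ≤ 2t, two distinct t-sets with
-- union [r] then leave fewer than t colours for the edge between their vertices. If r > 2t, take
-- petals A = S + a and B = S + b with |S| = t − 1: the edge w_A w_B carries S and some colour c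
-- outside A ∪ B. For a t-set Z ∋ c disjoint from A ∪ B, the colour sets of w_Z w_A and w_Z w_B lie in
-- the complement of Z ∪ S, which has r − 2t + 1 < 2t colours, so they share a colour d; by
-- transitivity d is a colour of w_A w_B, and d ∉ Z ∪ S. So w_A w_B has the t + 1 colours S, c, d.

module Submission where

open import Defs
open import Data.Bool as Bool using ()
open import Data.Empty using (⊥; ⊥-elim)
open import Data.Fin using (Fin; zero; suc)
open import Data.Fin.Properties using (_≟_; any?)
open import Data.Fin.Subset renaming (⊥ to ∅)
open import Data.Fin.Subset.Properties
open import Data.List using (List; []; _∷_; length; map)
open import Data.List.Membership.Propositional using (lose) renaming (_∈_ to _∈ₗ_)
open import Data.List.Membership.Propositional.Properties using (∈-map⁺)
open import Data.List.Properties using (length-map)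
open import Data.List.Relation.Unary.Any as Any using (Any)
open import Data.Nat as ℕ using (ℕ; zero; suc; _≤_; _<_; _+_; _*_; _∸_; z≤n; s≤s)
open import Data.Nat.Properties hiding (_≟_)
open import Data.Nat.Tactic.RingSolver using (solve-∀)
open import Data.Product using (Σ; ∃; _×_; _,_; proj₁; proj₂)
open import Data.Sum using (_⊎_; inj₁; inj₂; [_,_]′)
open import Data.Vec using ([]; _∷_; here; there)
open import Data.Vec.Properties using (≡-dec)
open import Function using (_∘_)
open import Relation.Binary.PropositionalEquality
open import Relation.Nullary using (¬_; yes; no; contradiction)
open import Relation.Nullary.Decidable using (Dec; map′; ¬?; _×-dec_; decidable-stable)

private variable
  n r : ℕ
  p q u : Subset n
  x y : Fin n

∣p∪q∣+∣p∩q∣≡∣p∣+∣q∣ : ∀ (p q : Subset n) → ∣ p ∪ q ∣ + ∣ p ∩ q ∣ ≡ ∣ p ∣ + ∣ q ∣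
∣p∪q∣+∣p∩q∣≡∣p∣+∣q∣ []            []            = refl
∣p∪q∣+∣p∩q∣≡∣p∣+∣q∣ (inside  ∷ p) (inside  ∷ q) = cong suc (begin
  ∣ p ∪ q ∣ + suc ∣ p ∩ q ∣   ≡⟨ +-suc _ _ ⟩
  suc (∣ p ∪ q ∣ + ∣ p ∩ q ∣) ≡⟨ cong suc (∣p∪q∣+∣p∩q∣≡∣p∣+∣q∣ p q) ⟩
  suc (∣ p ∣ + ∣ q ∣)         ≡⟨ +-suc _ _ ⟨
  ∣ p ∣ + suc ∣ q ∣           ∎)
  where open ≡-Reasoning
∣p∪q∣+∣p∩q∣≡∣p∣+∣q∣ (inside  ∷ p) (outside ∷ q) = cong suc (∣p∪q∣+∣p∩q∣≡∣p∣+∣q∣ p q)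
∣p∪q∣+∣p∩q∣≡∣p∣+∣q∣ (outside ∷ p) (inside  ∷ q) =
  trans (cong suc (∣p∪q∣+∣p∩q∣≡∣p∣+∣q∣ p q)) (sym (+-suc _ _))
∣p∪q∣+∣p∩q∣≡∣p∣+∣q∣ (outside ∷ p) (outside ∷ q) = ∣p∪q∣+∣p∩q∣≡∣p∣+∣q∣ p q

Empty⇒∣p∣≡0 : Empty p → ∣ p ∣ ≡ 0
Empty⇒∣p∣≡0 {n} empty = trans (cong ∣_∣ (Empty-unique empty)) (∣⊥∣≡0 n)

0<∣p∣⇒Nonempty : 0 < ∣ p ∣ → Nonempty p
0<∣p∣⇒Nonempty {p = p} 0<∣p∣ with nonempty? p
... | yes nonempty = nonempty
... | no  empty    = contradiction (Empty⇒∣p∣≡0 empty) (>⇒≢ 0<∣p∣)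

Empty[p∩q]⇒∣p∪q∣≡∣p∣+∣q∣ : ∀ (p q : Subset n) → Empty (p ∩ q) → ∣ p ∪ q ∣ ≡ ∣ p ∣ + ∣ q ∣
Empty[p∩q]⇒∣p∪q∣≡∣p∣+∣q∣ p q empty = begin
  ∣ p ∪ q ∣             ≡⟨ +-identityʳ _ ⟨
  ∣ p ∪ q ∣ + 0         ≡⟨ cong (∣ p ∪ q ∣ +_) (Empty⇒∣p∣≡0 empty) ⟨
  ∣ p ∪ q ∣ + ∣ p ∩ q ∣ ≡⟨ ∣p∪q∣+∣p∩q∣≡∣p∣+∣q∣ p q ⟩
  ∣ p ∣ + ∣ q ∣         ∎
  where open ≡-Reasoning

x∉p⇒∣⁅x⁆∪p∣≡1+∣p∣ : x ∉ p → ∣ ⁅ x ⁆ ∪ p ∣ ≡ suc ∣ p ∣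
x∉p⇒∣⁅x⁆∪p∣≡1+∣p∣ {x = x} {p} x∉p = begin
  ∣ ⁅ x ⁆ ∪ p ∣     ≡⟨ Empty[p∩q]⇒∣p∪q∣≡∣p∣+∣q∣ ⁅ x ⁆ p disjoint ⟩
  ∣ ⁅ x ⁆ ∣ + ∣ p ∣ ≡⟨ cong (_+ ∣ p ∣) (∣⁅x⁆∣≡1 x) ⟩
  suc ∣ p ∣         ∎
  where
  open ≡-Reasoning
  disjoint : Empty (⁅ x ⁆ ∩ p)
  disjoint (y , y∈⁅x⁆∩p) with x∈p∩q⁻ ⁅ x ⁆ p y∈⁅x⁆∩p
  ... | y∈⁅x⁆ , y∈p = x∉p (subst (_∈ p) (x∈⁅y⁆⇒x≡y x y∈⁅x⁆) y∈p)

∣u∣<∣p∣+∣q∣⇒Nonempty[p∩q] : p ⊆ u → q ⊆ u → ∣ u ∣ < ∣ p ∣ + ∣ q ∣ → Nonempty (p ∩ q)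
∣u∣<∣p∣+∣q∣⇒Nonempty[p∩q] {p = p} {u} {q} p⊆u q⊆u ∣u∣<∣p∣+∣q∣ =
  0<∣p∣⇒Nonempty (n≢0⇒n>0 ∣p∩q∣≢0)
  where
  p∪q⊆u : p ∪ q ⊆ u
  p∪q⊆u x∈p∪q = [ p⊆u , q⊆u ]′ (x∈p∪q⁻ p q x∈p∪q)
  ∣p∩q∣≢0 : ∣ p ∩ q ∣ ≢ 0
  ∣p∩q∣≢0 ∣p∩q∣≡0 = <⇒≱ ∣u∣<∣p∣+∣q∣ (begin
    ∣ p ∣ + ∣ q ∣         ≡⟨ ∣p∪q∣+∣p∩q∣≡∣p∣+∣q∣ p q ⟨
    ∣ p ∪ q ∣ + ∣ p ∩ q ∣ ≡⟨ cong (∣ p ∪ q ∣ +_) ∣p∩q∣≡0 ⟩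
    ∣ p ∪ q ∣ + 0         ≡⟨ +-identityʳ _ ⟩
    ∣ p ∪ q ∣             ≤⟨ p⊆q⇒∣p∣≤∣q∣ p∪q⊆u ⟩
    ∣ u ∣                 ∎)
    where open ≤-Reasoning

interpolate : ∀ k → p ⊆ q → ∣ p ∣ ≤ k → k ≤ ∣ q ∣ →
              ∃ λ (s : Subset n) → p ⊆ s × s ⊆ q × ∣ s ∣ ≡ k
interpolate {p = []} {[]} zero p⊆q _ _ = [] , p⊆q , p⊆q , refl
interpolate {p = inside ∷ p} {inside ∷ q} (suc k) p⊆q (s≤s ∣p∣≤k) (s≤s k≤∣q∣)
  with interpolate k (drop-∷-⊆ p⊆q) ∣p∣≤k k≤∣q∣
... | s , p⊆s , s⊆q , ∣s∣≡k = inside ∷ s , in⊆in p⊆s , in⊆in s⊆q , cong suc ∣s∣≡k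
interpolate {p = inside ∷ p} {outside ∷ q} k p⊆q _ _ = contradiction (p⊆q here) λ ()
interpolate {p = outside ∷ p} {outside ∷ q} k p⊆q ∣p∣≤k k≤∣q∣
  with interpolate k (drop-∷-⊆ p⊆q) ∣p∣≤k k≤∣q∣
... | s , p⊆s , s⊆q , ∣s∣≡k = outside ∷ s , out⊆ p⊆s , out⊆ s⊆q , ∣s∣≡k
interpolate {p = outside ∷ p} {inside ∷ q} k p⊆q ∣p∣≤k k≤1+∣q∣ with k ≤? ∣ q ∣
... | yes k≤∣q∣ with interpolate k (drop-∷-⊆ p⊆q) ∣p∣≤k k≤∣q∣
...   | s , p⊆s , s⊆q , ∣s∣≡k = outside ∷ s , out⊆ p⊆s , out⊆ s⊆q , ∣s∣≡k
interpolate {p = outside ∷ p} {inside ∷ q} k p⊆q ∣p∣≤k k≤1+∣q∣ | no k≰∣q∣ =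
  inside ∷ q , p⊆q , ⊆-refl , ≤-antisym (≰⇒> k≰∣q∣) k≤1+∣q∣

p⊆q∧∣q∣≤∣p∣⇒p≡q : p ⊆ q → ∣ q ∣ ≤ ∣ p ∣ → p ≡ q
p⊆q∧∣q∣≤∣p∣⇒p≡q {p = p} {q} p⊆q ∣q∣≤∣p∣ = ⊆-antisym p⊆q q⊆p
  where
  q⊆p : q ⊆ p
  q⊆p {x} x∈q with x ∈? p
  ... | yes x∈p = x∈p
  ... | no  x∉p = contradiction (p⊂q⇒∣p∣<∣q∣ (p⊆q , x , x∈q , x∉p)) (≤⇒≯ ∣q∣≤∣p∣)

elements : Subset n → List (Fin n)
elements []            = []
elements (inside  ∷ p) = zero ∷ map suc (elements p)
elements (outside ∷ p) = map suc (elements p)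

length-elements : ∀ (p : Subset n) → length (elements p) ≡ ∣ p ∣
length-elements []            = refl
length-elements (inside  ∷ p) = cong suc (trans (length-map suc (elements p)) (length-elements p))
length-elements (outside ∷ p) = trans (length-map suc (elements p)) (length-elements p)

∈-elements : x ∈ p → x ∈ₗ elements p
∈-elements {p = inside  ∷ p} here          = Any.here refl
∈-elements {p = inside  ∷ p} (there x∈p)   = Any.there (∈-map⁺ suc (∈-elements x∈p))
∈-elements {p = outside ∷ p} (there x∈p)   = ∈-map⁺ suc (∈-elements x∈p)

∣p∣≡k⇒∣∁p∣≡n∸k : ∀ {n k} (p : Subset n) → ∣ p ∣ ≡ k → ∣ ∁ p ∣ ≡ n ∸ k
∣p∣≡k⇒∣∁p∣≡n∸k {n} p ∣p∣≡k = trans (∣∁p∣≡n∸∣p∣ p) (cong (n ∸_) ∣p∣≡k)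

∃-ofSize : ∀ {k n} → k ≤ n → ∃ λ (p : Subset n) → ∣ p ∣ ≡ k
∃-ofSize {k} {n} k≤n
  with interpolate {p = ∅} {q = ⊤} k ⊥⊆ (≤-trans (≤-reflexive (∣⊥∣≡0 n)) z≤n)
                                       (≤-trans k≤n (≤-reflexive (sym (∣⊤∣≡n n))))
... | p , _ , _ , ∣p∣≡k = p , ∣p∣≡k

∃-covering-pair : ∀ {k n} → k < n → n ≤ k + k →
                  ∃ λ (p : Subset n) → ∃ λ q → ∣ p ∣ ≡ k × ∣ q ∣ ≡ k × ∁ p ⊆ q × Nonempty (∁ p)
∃-covering-pair {k} {n} k<n n≤k+k with ∃-ofSize (<⇒≤ k<n)
... | p , ∣p∣≡k
  with interpolate {q = ⊤} k ⊆⊤ (≤-trans (≤-reflexive (∣p∣≡k⇒∣∁p∣≡n∸k p ∣p∣≡k)) (m≤n+o⇒m∸n≤o n k n≤k+k))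
                                (≤-trans (<⇒≤ k<n) (≤-reflexive (sym (∣⊤∣≡n n))))
... | q , ∁p⊆q , _ , ∣q∣≡k = p , q , ∣p∣≡k , ∣q∣≡k , ∁p⊆q ,
  0<∣p∣⇒Nonempty {p = ∁ p} (subst (0 <_) (sym (∣p∣≡k⇒∣∁p∣≡n∸k p ∣p∣≡k)) (m<n⇒0<n∸m k<n))

x∈⁅y⁆∪p⁻ : ∀ y (p : Subset n) → x ∈ ⁅ y ⁆ ∪ p → x ≡ y ⊎ x ∈ p
x∈⁅y⁆∪p⁻ y p x∈⁅y⁆∪p with x∈p∪q⁻ ⁅ y ⁆ p x∈⁅y⁆∪p
... | inj₁ x∈⁅y⁆ = inj₁ (x∈⁅y⁆⇒x≡y y x∈⁅y⁆)
... | inj₂ x∈p   = inj₂ x∈p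

p⊆q-x-y⇒2+∣p∣≤∣q∣ : x ∈ q → y ∈ q - x → p ⊆ q - x - y → 2 + ∣ p ∣ ≤ ∣ q ∣
p⊆q-x-y⇒2+∣p∣≤∣q∣ {x = x} {q} {y} {p} x∈q y∈q-x p⊆q-x-y = begin
  2 + ∣ p ∣           ≤⟨ s≤s (s≤s (p⊆q⇒∣p∣≤∣q∣ p⊆q-x-y)) ⟩
  2 + ∣ q - x - y ∣   ≤⟨ s≤s (x∈p⇒∣p-x∣<∣p∣ y∈q-x) ⟩
  suc ∣ q - x ∣       ≤⟨ x∈p⇒∣p-x∣<∣p∣ x∈q ⟩
  ∣ q ∣               ∎
  where open ≤-Reasoning

∣q∣≤∣p∣∧p≢q⇒∃[p∖q] : ∣ q ∣ ≤ ∣ p ∣ → p ≢ q → ∃ λ x → x ∈ p × x ∉ q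
∣q∣≤∣p∣∧p≢q⇒∃[p∖q] {q = q} {p = p} ∣q∣≤∣p∣ p≢q with any? (λ x → (x ∈? p) ×-dec ¬? (x ∈? q))
... | yes p∖q-nonempty = p∖q-nonempty
... | no  p∖q-empty    = contradiction (p⊆q∧∣q∣≤∣p∣⇒p≡q p⊆q ∣q∣≤∣p∣) p≢q
  where
  p⊆q : p ⊆ q
  p⊆q {x} x∈p = decidable-stable (x ∈? q) λ x∉q → p∖q-empty (x , x∈p , x∉q)

record Realised (col : Colouring n r) (v : Fin n) (T : Subset r) : Set where
  constructor realised
  field
    vertex   : Fin n
    vertex≢v : vertex ≢ v
    colours  : col v vertex ≡ T

Saturated : ℕ → Colouring n r → Fin n → Set
Saturated {r = r} t col v = (T : Subset r) → ∣ T ∣ ≡ t → Realised col v T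

ComponentCover : Colouring n r → ℕ → Set
ComponentCover {n} {r} col k = Σ (List (Fin r × Fin n)) λ L →
  (length L ≤ k) × ((w : Fin n) → Any (λ p → Reach col (proj₁ p) (proj₂ p) w) L)

realised? : (col : Colouring n r) (v : Fin n) (T : Subset r) → Dec (Realised col v T)
realised? col v T = map′ (λ (w , w≢v , colours) → realised w w≢v colours)
                         (λ (realised w w≢v colours) → w , w≢v , colours)
                         (any? (λ w → ¬? (w ≟ v) ×-dec ≡-dec Bool._≟_ (col v w) T))

missing-or-saturated : (t : ℕ) (col : Colouring n r) (v : Fin n) →
                       (∃ λ T → ∣ T ∣ ≡ t × ¬ Realised col v T) ⊎ Saturated t col v
missing-or-saturated t col v with anySubset? (λ T → (∣ T ∣ ℕ.≟ t) ×-dec ¬? (realised? col v T))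
... | yes missing  = inj₁ missing
... | no  ¬missing = inj₂ λ T ∣T∣≡t →
  decidable-stable (realised? col v T) λ ¬realised → ¬missing (T , ∣T∣≡t , ¬realised)

missing⇒cover : ∀ {t} {col : Colouring n r} {v T} → ExactlyColours t col → t < r → ∣ T ∣ ≡ t →
                ¬ Realised col v T → ComponentCover col (r ∸ t)
missing⇒cover {r = r} {t} {col} {v} {T} exact t<r ∣T∣≡t missing =
  L , ≤-reflexive length-L , covered
  where
  L : List (Fin r × Fin _)
  L = map (_, v) (elements (∁ T))
  length-L : length L ≡ r ∸ t
  length-L = trans (length-map _ (elements (∁ T)))
                   (trans (length-elements (∁ T)) (∣p∣≡k⇒∣∁p∣≡n∸k T ∣T∣≡t))
  reached-from-v : ∀ {i w} → i ∉ T → Reach col i v w → Any (λ p → Reach col (proj₁ p) (proj₂ p) w) L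
  reached-from-v i∉T = lose (∈-map⁺ (_, v) (∈-elements (x∉p⇒x∈∁p i∉T)))
  covered : (w : Fin _) → Any (λ p → Reach col (proj₁ p) (proj₂ p) w) L
  covered w with w ≟ v
  ... | yes refl
    with 0<∣p∣⇒Nonempty {p = ∁ T} (subst (0 <_) (sym (∣p∣≡k⇒∣∁p∣≡n∸k T ∣T∣≡t)) (m<n⇒0<n∸m t<r))
  ...   | i , i∈∁T = reached-from-v (x∈∁p⇒x∉p i∈∁T) here
  covered w | no w≢v with ∣q∣≤∣p∣∧p≢q⇒∃[p∖q] (≤-reflexive (trans ∣T∣≡t (sym (exact v w (≢-sym w≢v)))))
                             (λ colours → missing (realised w w≢v colours))
  ...   | i , i∈col , i∉T = reached-from-v i∉T (step (≢-sym w≢v) i∈col here)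

module Neighbourhood {col : Colouring n r} (symmetric : Symmetric col)
                     (transitive : Transitive col) (v : Fin n) where

  open Realised

  private variable
    i : Fin r
    T U : Subset r

  ∈-col-sym : ∀ {x y} → x ≢ y → i ∈ col x y → i ∈ col y x
  ∈-col-sym {x = x} {y = y} x≢y = subst (_ ∈_) (symmetric x y x≢y)

  triangle : ∀ {x y z} → x ≢ y → x ≢ z → y ≢ z → col x y ∩ col x z ⊆ col y z
  triangle {x = x} {y = y} {z = z} x≢y x≢z y≢z i∈∩ with x∈p∩q⁻ (col x y) (col x z) i∈∩
  ... | i∈xy , i∈xz = transitive y x z _ (≢-sym x≢y) x≢z y≢z (∈-col-sym x≢y i∈xy) i∈xz

  link : Realised col v T → Realised col v U → Subset r
  link x y = col (vertex x) (vertex y)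

  ∈-colours⁺ : (x : Realised col v T) → i ∈ T → i ∈ col v (vertex x)
  ∈-colours⁺ x = subst (_ ∈_) (sym (colours x))

  ∈-colours⁻ : (x : Realised col v T) → i ∈ col v (vertex x) → i ∈ T
  ∈-colours⁻ x = subst (_ ∈_) (colours x)

  vertex-≢ : (x : Realised col v T) (y : Realised col v U) → i ∈ T → i ∉ U → vertex x ≢ vertex y
  vertex-≢ x y i∈T i∉U x≡y =
    i∉U (∈-colours⁻ y (subst (λ w → _ ∈ col v w) x≡y (∈-colours⁺ x i∈T)))

  module _ (x : Realised col v T) (y : Realised col v U) (x≢y : vertex x ≢ vertex y) where

    ∩⊆link : T ∩ U ⊆ link x y
    ∩⊆link i∈T∩U with x∈p∩q⁻ T U i∈T∩U
    ... | i∈T , i∈U = triangle (≢-sym (vertex≢v x)) (≢-sym (vertex≢v y)) x≢y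
                        (x∈p∩q⁺ (∈-colours⁺ x i∈T , ∈-colours⁺ y i∈U))

    link-transfer : i ∈ link x y → i ∈ T → i ∈ U
    link-transfer i∈link i∈T = ∈-colours⁻ y
      (transitive v (vertex x) (vertex y) _ (≢-sym (vertex≢v x)) x≢y (≢-sym (vertex≢v y))
        (∈-colours⁺ x i∈T) i∈link)

  link-transferʳ : (x : Realised col v T) (y : Realised col v U) → vertex x ≢ vertex y →
                   i ∈ link x y → i ∈ U → i ∈ T
  link-transferʳ x y x≢y i∈link = link-transfer y x (≢-sym x≢y) (∈-col-sym x≢y i∈link)

  link-∉-disjoint : (x : Realised col v T) (y : Realised col v U) → vertex x ≢ vertex y →
                    Empty (T ∩ U) → i ∈ link x y → i ∉ T × i ∉ U
  link-∉-disjoint x y x≢y empty i∈link =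
    (λ i∈T → empty (_ , x∈p∩q⁺ (i∈T , link-transfer x y x≢y i∈link i∈T))) ,
    (λ i∈U → empty (_ , x∈p∩q⁺ (link-transferʳ x y x≢y i∈link i∈U , i∈U)))

  ∁T⊆U⇒∣link∣<∣U∣ : (x : Realised col v T) (y : Realised col v U) → ∁ T ⊆ U → i ∉ T →
                     ∣ link x y ∣ < ∣ U ∣
  ∁T⊆U⇒∣link∣<∣U∣ {T} {U} {j} x y ∁T⊆U j∉T = begin-strict
    ∣ link x y ∣ ≤⟨ p⊆q⇒∣p∣≤∣q∣ link⊆U-j ⟩
    ∣ U - j ∣    <⟨ x∈p⇒∣p-x∣<∣p∣ j∈U ⟩
    ∣ U ∣        ∎
    where
    open ≤-Reasoning
    j∈U : j ∈ U
    j∈U = ∁T⊆U (x∉p⇒x∈∁p j∉T)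
    x≢y : vertex x ≢ vertex y
    x≢y = ≢-sym (vertex-≢ y x j∈U j∉T)
    link⊆U-j : link x y ⊆ U - j
    link⊆U-j {i} i∈link with i ∈? T
    ... | yes i∈T = x∈p∧x≢y⇒x∈p-y (link-transfer x y x≢y i∈link i∈T) λ { refl → j∉T i∈T }
    ... | no  i∉T = contradiction (link-transferʳ x y x≢y i∈link (∁T⊆U (x∉p⇒x∈∁p i∉T))) i∉T

  ¬saturated-r≤2t : ∀ {t} → ExactlyColours t col → t < r → r ≤ t + t → ¬ Saturated t col v
  ¬saturated-r≤2t exact t<r r≤t+t saturated with ∃-covering-pair t<r r≤t+t
  ... | T , U , ∣T∣≡t , ∣U∣≡t , ∁T⊆U , j , j∈∁T =
    <-irrefl (trans (exact _ _ wT≢wU) (sym ∣U∣≡t)) (∁T⊆U⇒∣link∣<∣U∣ wT wU ∁T⊆U (x∈∁p⇒x∉p j∈∁T))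
    where
    wT = saturated T ∣T∣≡t
    wU = saturated U ∣U∣≡t
    wT≢wU : vertex wT ≢ vertex wU
    wT≢wU = ≢-sym (vertex-≢ wU wT (∁T⊆U j∈∁T) (x∈∁p⇒x∉p j∈∁T))

  module Petals {s : ℕ} (exact : ExactlyColours (suc s) col) (saturated : Saturated (suc s) col v)
                (2+2s<r : suc s + suc s < r) (r≤4s+2 : r ≤ (suc s + s) + (suc s + s)) where

    1+s<r : suc s < r
    1+s<r = ≤-trans (s≤s (m≤m+n (suc s) (suc s))) 2+2s<r

    s<r : s < r
    s<r = <-trans (n<1+n s) 1+s<r

    module Configuration {S : Subset r} (∣S∣≡s : ∣ S ∣ ≡ s)
                         {a b : Fin r} (a∉S : a ∉ S) (b∉A : b ∉ ⁅ a ⁆ ∪ S) where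

      A B M : Subset r
      A = ⁅ a ⁆ ∪ S
      B = ⁅ b ⁆ ∪ S
      M = ⁅ b ⁆ ∪ A

      b∉S : b ∉ S
      b∉S = b∉A ∘ q⊆p∪q ⁅ a ⁆ S

      a∈A : a ∈ A
      a∈A = p⊆p∪q S (x∈⁅x⁆ a)

      b∈B : b ∈ B
      b∈B = p⊆p∪q S (x∈⁅x⁆ b)

      a∉B : a ∉ B
      a∉B a∈B with x∈⁅y⁆∪p⁻ b S a∈B
      ... | inj₁ a≡b = b∉A (subst (_∈ A) a≡b a∈A)
      ... | inj₂ a∈S = a∉S a∈S

      S⊆A : S ⊆ A
      S⊆A = q⊆p∪q ⁅ a ⁆ S

      S⊆B : S ⊆ B
      S⊆B = q⊆p∪q ⁅ b ⁆ S

      A⊆M : A ⊆ M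
      A⊆M = q⊆p∪q ⁅ b ⁆ A

      B⊆M : B ⊆ M
      B⊆M i∈B with x∈⁅y⁆∪p⁻ b S i∈B
      ... | inj₁ refl = p⊆p∪q A (x∈⁅x⁆ b)
      ... | inj₂ i∈S  = A⊆M (S⊆A i∈S)

      ∣A∣≡1+s : ∣ A ∣ ≡ suc s
      ∣A∣≡1+s = trans (x∉p⇒∣⁅x⁆∪p∣≡1+∣p∣ a∉S) (cong suc ∣S∣≡s)

      ∣B∣≡1+s : ∣ B ∣ ≡ suc s
      ∣B∣≡1+s = trans (x∉p⇒∣⁅x⁆∪p∣≡1+∣p∣ b∉S) (cong suc ∣S∣≡s)

      ∣M∣≡2+s : ∣ M ∣ ≡ suc (suc s)
      ∣M∣≡2+s = trans (x∉p⇒∣⁅x⁆∪p∣≡1+∣p∣ b∉A) (cong suc ∣A∣≡1+s)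

      wA = saturated A ∣A∣≡1+s
      wB = saturated B ∣B∣≡1+s

      wA≢wB : vertex wA ≢ vertex wB
      wA≢wB = vertex-≢ wA wB a∈A a∉B

      X : Subset r
      X = link wA wB

      S⊆X : S ⊆ X
      S⊆X i∈S = ∩⊆link wA wB wA≢wB (x∈p∩q⁺ (S⊆A i∈S , S⊆B i∈S))

      X-S⊆∁M : i ∈ X → i ∉ S → i ∈ ∁ M
      X-S⊆∁M {i} i∈X i∉S = x∉p⇒x∈∁p i∉M
        where
        i∉M : i ∉ M
        i∉M i∈M with x∈⁅y⁆∪p⁻ b A i∈M
        ... | inj₁ refl = b∉A (link-transferʳ wA wB wA≢wB i∈X b∈B)
        ... | inj₂ i∈A with x∈⁅y⁆∪p⁻ b S (link-transfer wA wB wA≢wB i∈X i∈A)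
        ...   | inj₁ refl = b∉A i∈A
        ...   | inj₂ i∈S  = i∉S i∈S

      module Centre {Z : Subset r} (Z⊆∁M : Z ⊆ ∁ M) (∣Z∣≡1+s : ∣ Z ∣ ≡ suc s) where

        wZ = saturated Z ∣Z∣≡1+s

        Empty[Z∩T] : ∀ {T} → T ⊆ M → Empty (Z ∩ T)
        Empty[Z∩T] {T} T⊆M (i , i∈Z∩T) with x∈p∩q⁻ Z T i∈Z∩T
        ... | i∈Z , i∈T = x∈∁p⇒x∉p (Z⊆∁M i∈Z) (T⊆M i∈T)

        wZ≢ : (w : Realised col v T) → T ⊆ M → vertex wZ ≢ vertex w
        wZ≢ {T} w T⊆M with 0<∣p∣⇒Nonempty {p = Z} (subst (0 <_) (sym ∣Z∣≡1+s) (s≤s z≤n))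
        ... | i , i∈Z = vertex-≢ wZ w i∈Z λ i∈T → Empty[Z∩T] T⊆M (i , x∈p∩q⁺ (i∈Z , i∈T))

        link⊆∁[Z∪S] : (w : Realised col v T) → T ⊆ M → S ⊆ T → link wZ w ⊆ ∁ (Z ∪ S)
        link⊆∁[Z∪S] {T} w T⊆M S⊆T i∈link
          with link-∉-disjoint wZ w (wZ≢ w T⊆M) (Empty[Z∩T] T⊆M) i∈link
        ... | i∉Z , i∉T = x∉p⇒x∈∁p λ i∈Z∪S → [ i∉Z , i∉T ∘ S⊆T ]′ (x∈p∪q⁻ Z S i∈Z∪S)

        ∣∁[Z∪S]∣<∣link∣+∣link∣ : ∣ ∁ (Z ∪ S) ∣ < ∣ link wZ wA ∣ + ∣ link wZ wB ∣
        ∣∁[Z∪S]∣<∣link∣+∣link∣ = begin-strict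
          ∣ ∁ (Z ∪ S) ∣           ≡⟨ ∣p∣≡k⇒∣∁p∣≡n∸k (Z ∪ S) ∣Z∪S∣≡1+2s ⟩
          r ∸ (suc s + s)         ≤⟨ m≤n+o⇒m∸n≤o r (suc s + s) r≤4s+2 ⟩
          suc s + s               <⟨ +-monoʳ-< (suc s) (n<1+n s) ⟩
          suc s + suc s           ≡⟨ cong₂ _+_ (exact _ _ (wZ≢ wA A⊆M)) (exact _ _ (wZ≢ wB B⊆M)) ⟨
          ∣ link wZ wA ∣ + ∣ link wZ wB ∣ ∎
          where
          open ≤-Reasoning
          ∣Z∪S∣≡1+2s : ∣ Z ∪ S ∣ ≡ suc s + s
          ∣Z∪S∣≡1+2s = trans (Empty[p∩q]⇒∣p∪q∣≡∣p∣+∣q∣ Z S (Empty[Z∩T] (A⊆M ∘ S⊆A)))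
                             (cong₂ _+_ ∣Z∣≡1+s ∣S∣≡s)

        X⊈Z∪S : ∃ λ d → d ∈ X × d ∉ Z × d ∉ S
        X⊈Z∪S with ∣u∣<∣p∣+∣q∣⇒Nonempty[p∩q] (link⊆∁[Z∪S] wA A⊆M S⊆A) (link⊆∁[Z∪S] wB B⊆M S⊆B)
                                             ∣∁[Z∪S]∣<∣link∣+∣link∣
        ... | d , d∈links with x∈∁p⇒x∉p (link⊆∁[Z∪S] wA A⊆M S⊆A (proj₁ (x∈p∩q⁻ _ _ d∈links)))
        ... | d∉Z∪S = d , triangle (wZ≢ wA A⊆M) (wZ≢ wB B⊆M) wA≢wB d∈links ,
                      d∉Z∪S ∘ p⊆p∪q S , d∉Z∪S ∘ q⊆p∪q Z S

      X⊈S : ∃ λ c → c ∈ X × c ∉ S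
      X⊈S with ∣u∣<∣p∣+∣q∣⇒Nonempty[p∩q] {p = X} {u = ⊤} {q = ∁ S} ⊆⊤ ⊆⊤ ∣⊤∣<∣X∣+∣∁S∣
        where
        open ≤-Reasoning
        ∣⊤∣<∣X∣+∣∁S∣ : ∣ ⊤ {r} ∣ < ∣ X ∣ + ∣ ∁ S ∣
        ∣⊤∣<∣X∣+∣∁S∣ = begin-strict
          ∣ ⊤ {r} ∣         ≡⟨ ∣⊤∣≡n r ⟩
          r                 ≡⟨ m+[n∸m]≡n (<⇒≤ s<r) ⟨
          s + (r ∸ s)       <⟨ n<1+n _ ⟩
          suc s + (r ∸ s)   ≡⟨ cong₂ _+_ (exact _ _ wA≢wB) (∣p∣≡k⇒∣∁p∣≡n∸k S ∣S∣≡s) ⟨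
          ∣ X ∣ + ∣ ∁ S ∣   ∎
      ... | c , c∈X∩∁S with x∈p∩q⁻ X (∁ S) c∈X∩∁S
      ... | c∈X , c∈∁S = c , c∈X , x∈∁p⇒x∉p c∈∁S

      ⁅c⁆⊆∁M : ∀ {c} → c ∈ X → c ∉ S → ⁅ c ⁆ ⊆ ∁ M
      ⁅c⁆⊆∁M {c} c∈X c∉S j∈⁅c⁆ = subst (_∈ ∁ M) (sym (x∈⁅y⁆⇒x≡y c j∈⁅c⁆)) (X-S⊆∁M c∈X c∉S)

      1+s≤∣∁M∣ : suc s ≤ ∣ ∁ M ∣
      1+s≤∣∁M∣ = subst (suc s ≤_) (sym (∣p∣≡k⇒∣∁p∣≡n∸k M ∣M∣≡2+s))
                   (m+n≤o⇒m≤o∸n (suc s) (subst (_≤ r) (sym (+-suc (suc s) (suc s))) 2+2s<r))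

      too-many-colours : ∀ {c d} → c ∈ X → d ∈ X → c ∉ S → d ∉ S → d ≢ c → ⊥
      too-many-colours {c} {d} c∈X d∈X c∉S d∉S d≢c = 1+n≰n (begin
        suc (suc s)       ≡⟨ cong (2 +_) ∣S∣≡s ⟨
        2 + ∣ S ∣         ≤⟨ p⊆q-x-y⇒2+∣p∣≤∣q∣ c∈X (x∈p∧x≢y⇒x∈p-y d∈X d≢c) S⊆X-c-d ⟩
        ∣ X ∣             ≡⟨ exact _ _ wA≢wB ⟩
        suc s             ∎)
        where
        open ≤-Reasoning
        S⊆X-c-d : S ⊆ X - c - d
        S⊆X-c-d i∈S =
          x∈p∧x≢y⇒x∈p-y (x∈p∧x≢y⇒x∈p-y (S⊆X i∈S) λ { refl → c∉S i∈S }) λ { refl → d∉S i∈S }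

      impossible : ⊥
      impossible =
        let c , c∈X , c∉S = X⊈S
            Z , ⁅c⁆⊆Z , Z⊆∁M , ∣Z∣≡1+s =
              interpolate {p = ⁅ c ⁆} {q = ∁ M} (suc s) (⁅c⁆⊆∁M c∈X c∉S)
                          (≤-trans (≤-reflexive (∣⁅x⁆∣≡1 c)) (s≤s z≤n)) 1+s≤∣∁M∣
            d , d∈X , d∉Z , d∉S = Centre.X⊈Z∪S Z⊆∁M ∣Z∣≡1+s
        in too-many-colours c∈X d∈X c∉S d∉S λ d≡c → d∉Z (subst (_∈ Z) (sym d≡c) (⁅c⁆⊆Z (x∈⁅x⁆ c)))

    impossible : ⊥
    impossible =
      let S , ∣S∣≡s = ∃-ofSize (<⇒≤ s<r)
          a , a∈∁S = 0<∣p∣⇒Nonempty {p = ∁ S}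
                       (subst (0 <_) (sym (∣p∣≡k⇒∣∁p∣≡n∸k S ∣S∣≡s)) (m<n⇒0<n∸m s<r))
          a∉S = x∈∁p⇒x∉p a∈∁S
          ∣A∣≡1+s = trans (x∉p⇒∣⁅x⁆∪p∣≡1+∣p∣ a∉S) (cong suc ∣S∣≡s)
          b , b∈∁A = 0<∣p∣⇒Nonempty {p = ∁ (⁅ a ⁆ ∪ S)}
                       (subst (0 <_) (sym (∣p∣≡k⇒∣∁p∣≡n∸k (⁅ a ⁆ ∪ S) ∣A∣≡1+s)) (m<n⇒0<n∸m 1+s<r))
      in Configuration.impossible ∣S∣≡s a∉S (x∈∁p⇒x∉p b∈∁A)

  ¬saturated : ∀ {t} → 1 ≤ t → t + 1 ≤ r → r ≤ 4 * t ∸ 2 → ExactlyColours t col → ¬ Saturated t col v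
  ¬saturated {suc s} _ t+1≤r r≤4t∸2 exact saturated with r ≤? suc s + suc s
  ... | yes r≤2t = ¬saturated-r≤2t exact (subst (_≤ r) (+-comm (suc s) 1) t+1≤r) r≤2t saturated
  ... | no  r≰2t = Petals.impossible exact saturated (≰⇒> r≰2t)
                     (subst (r ≤_) (cong (_∸ 2) (4[1+s]≡2+[1+2s]+[1+2s] s)) r≤4t∸2)
    where
    4[1+s]≡2+[1+2s]+[1+2s] : ∀ s → 4 * suc s ≡ 2 + ((suc s + s) + (suc s + s))
    4[1+s]≡2+[1+2s]+[1+2s] = solve-∀

lemma4 : (r t : ℕ) → 1 ≤ t → t + 1 ≤ r → r ≤ 4 * t ∸ 2 →
    (n : ℕ) (col : Colouring n r) →
    Symmetric col → Transitive col → ExactlyColours t col →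
    Σ (List (Fin r × Fin n)) λ L →
      (length L ≤ r ∸ t) ×
      ((w : Fin n) → Any (λ p → Reach col (proj₁ p) (proj₂ p) w) L)
lemma4 r t 1≤t t+1≤r r≤4t∸2 zero    col symmetric transitive exact = [] , z≤n , λ ()
lemma4 r t 1≤t t+1≤r r≤4t∸2 (suc n) col symmetric transitive exact with missing-or-saturated t col zero
... | inj₁ (T , ∣T∣≡t , missing) = missing⇒cover exact (subst (_≤ r) (+-comm t 1) t+1≤r) ∣T∣≡t missing
... | inj₂ saturated =
  ⊥-elim (Neighbourhood.¬saturated symmetric transitive zero 1≤t t+1≤r r≤4t∸2 exact saturated)
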